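{- For every $n$ there exists an injective $3$-Lipschitz map $\phi:\{0,1\}^n\to\{0,1\}^{2n+1}$ such that $\mathrm{XOR}(x)=\mathrm{Majority}(\phi(x))$ for all $x\in\{0,1\}^n$.
   Context: Distances are Hamming distances $\mathrm{dist}(x,y)=\sum_i|x_i-y_i|$; $\phi$ is $3$-Lipschitz if $\mathrm{dist}(\phi(x),\phi(y))\le 3\,\mathrm{dist}(x,y)$ for all $x,y$. $\mathrm{XOR}(x)=\sum_{i=1}^n x_i\bmod 2$ on $\{0,1\}^n$, and on $\{0,1\}^{m}$, $\mathrm{Majority}(z)=1$ if $\sum_i z_i>m/2$ and $0$ otherwise. -}

module Defs where

open import Data.Bool using (Bool; true; false; if_then_else_)
open import Data.Nat using (ℕ; zero; suc; _+_; _*_; _<_; _≤_; _%_; _<ᵇ_)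
open import Data.Vec using (Vec; []; _∷_)

bit : Bool → ℕ
bit true  = 1
bit false = 0

weight : ∀ {n} → Vec Bool n → ℕ
weight []       = 0
weight (b ∷ xs) = bit b + weight xs

dist : ∀ {n} → Vec Bool n → Vec Bool n → ℕ
dist []       []       = 0
dist (x ∷ xs) (y ∷ ys) = (if x Data.Bool.xor y then 1 else 0) + dist xs ys

XOR : ∀ {n} → Vec Bool n → Bool
XOR x = (weight x % 2) Data.Nat.≡ᵇ 1

Majority : ∀ {m} → Vec Bool m → Bool
Majority {m} z = m <ᵇ 2 * weight z

-- Send x to 0, followed by a block of length n whose last n - 2⌊|x|/2⌋ entries are ones,
-- followed by x itself. The weight of the image is n + (|x| mod 2), which is a strict
-- majority of 2n + 1 exactly when |x| is odd. Keeping x verbatim makes the map injective,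
-- and the block moves by at most 2 ∣ |x| - |y| ∣ ≤ 2 dist(x, y), whence the factor 3.
module Submission where

open import Defs
open import Data.Bool using (Bool; true; false; T)
open import Data.Bool.Properties using (T-≡)
open import Data.Nat using (ℕ; zero; suc; _+_; _*_; _≤_; _<_; _∸_; _%_; _<ᵇ_; _≡ᵇ_; ∣_-_∣; ⌊_/2⌋; z≤n; s≤s)
open import Data.Nat.Properties
open import Data.Unit using (tt)
open import Data.Vec using (Vec; []; _∷_; _++_)
open import Data.Vec.Properties using (∷-injectiveʳ; ++-injectiveˡ; ++-injectiveʳ)
open import Data.Product using (Σ; _×_; _,_)
open import Function.Bundles using (Equivalence)
open import Relation.Nullary using (contradiction)
open import Relation.Binary.PropositionalEquality

parity : ℕ → Bool
parity k = k % 2 ≡ᵇ 1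

2*⌊n/2⌋+parity≡n : ∀ n → 2 * ⌊ n /2⌋ + bit (parity n) ≡ n
2*⌊n/2⌋+parity≡n zero          = refl
2*⌊n/2⌋+parity≡n (suc zero)    = refl
2*⌊n/2⌋+parity≡n (suc (suc n)) =
  trans (cong (_+ bit (parity n)) (*-distribˡ-+ 2 1 ⌊ n /2⌋)) (cong (2 +_) (2*⌊n/2⌋+parity≡n n))

2*⌊n/2⌋≤n : ∀ n → 2 * ⌊ n /2⌋ ≤ n
2*⌊n/2⌋≤n n = subst (2 * ⌊ n /2⌋ ≤_) (2*⌊n/2⌋+parity≡n n) (m≤m+n _ _)

∣⌊m/2⌋-⌊n/2⌋∣≤∣m-n∣ : ∀ m n → ∣ ⌊ m /2⌋ - ⌊ n /2⌋ ∣ ≤ ∣ m - n ∣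
∣⌊m/2⌋-⌊n/2⌋∣≤∣m-n∣ zero          n             = ⌊n/2⌋≤n n
∣⌊m/2⌋-⌊n/2⌋∣≤∣m-n∣ (suc zero)    zero          = z≤n
∣⌊m/2⌋-⌊n/2⌋∣≤∣m-n∣ (suc zero)    (suc zero)    = z≤n
∣⌊m/2⌋-⌊n/2⌋∣≤∣m-n∣ (suc zero)    (suc (suc n)) = s≤s (⌊n/2⌋≤n n)
∣⌊m/2⌋-⌊n/2⌋∣≤∣m-n∣ (suc (suc m)) zero          = ⌊n/2⌋≤n (suc (suc m))
∣⌊m/2⌋-⌊n/2⌋∣≤∣m-n∣ (suc (suc m)) (suc zero)    = s≤s (⌊n/2⌋≤n m)
∣⌊m/2⌋-⌊n/2⌋∣≤∣m-n∣ (suc (suc m)) (suc (suc n)) = ∣⌊m/2⌋-⌊n/2⌋∣≤∣m-n∣ m n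

∣2*⌊m/2⌋-2*⌊n/2⌋∣≤2*∣m-n∣ : ∀ m n → ∣ 2 * ⌊ m /2⌋ - 2 * ⌊ n /2⌋ ∣ ≤ 2 * ∣ m - n ∣
∣2*⌊m/2⌋-2*⌊n/2⌋∣≤2*∣m-n∣ m n = begin
  ∣ 2 * ⌊ m /2⌋ - 2 * ⌊ n /2⌋ ∣ ≡⟨ *-distribˡ-∣-∣ 2 ⌊ m /2⌋ ⌊ n /2⌋ ⟨
  2 * ∣ ⌊ m /2⌋ - ⌊ n /2⌋ ∣     ≤⟨ *-monoʳ-≤ 2 (∣⌊m/2⌋-⌊n/2⌋∣≤∣m-n∣ m n) ⟩
  2 * ∣ m - n ∣                 ∎
  where open ≤-Reasoning

∣1+m-n∣≤1+∣m-n∣ : ∀ m n → ∣ suc m - n ∣ ≤ suc ∣ m - n ∣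
∣1+m-n∣≤1+∣m-n∣ zero    zero    = ≤-refl
∣1+m-n∣≤1+∣m-n∣ zero    (suc n) = m≤n⇒m≤1+n (n≤1+n n)
∣1+m-n∣≤1+∣m-n∣ (suc m) zero    = ≤-refl
∣1+m-n∣≤1+∣m-n∣ (suc m) (suc n) = ∣1+m-n∣≤1+∣m-n∣ m n

∣m-1+n∣≤1+∣m-n∣ : ∀ m n → ∣ m - suc n ∣ ≤ suc ∣ m - n ∣
∣m-1+n∣≤1+∣m-n∣ m n =
  subst₂ (λ u v → u ≤ suc v) (∣-∣-comm (suc n) m) (∣-∣-comm n m) (∣1+m-n∣≤1+∣m-n∣ n m)

<ᵇ-false : ∀ {m n} → n ≤ m → (m <ᵇ n) ≡ false
<ᵇ-false {m} {n} n≤m with m <ᵇ n in eq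
... | false = refl
... | true  = contradiction (<ᵇ⇒< m n (subst T (sym eq) tt)) (≤⇒≯ n≤m)

<ᵇ-true : ∀ {m n} → m < n → (m <ᵇ n) ≡ true
<ᵇ-true m<n = Equivalence.to T-≡ (<⇒<ᵇ m<n)

weight≤length : ∀ {n} (x : Vec Bool n) → weight x ≤ n
weight≤length []          = z≤n
weight≤length (true  ∷ x) = s≤s (weight≤length x)
weight≤length (false ∷ x) = m≤n⇒m≤1+n (weight≤length x)

weight-++ : ∀ {m n} (x : Vec Bool m) (y : Vec Bool n) → weight (x ++ y) ≡ weight x + weight y
weight-++ []      y = refl
weight-++ (b ∷ x) y = trans (cong (bit b +_) (weight-++ x y)) (sym (+-assoc (bit b) _ _))

dist-++ : ∀ {m n} (x x′ : Vec Bool m) (y y′ : Vec Bool n) →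
          dist (x ++ y) (x′ ++ y′) ≡ dist x x′ + dist y y′
dist-++ []      []       y y′ = refl
dist-++ (b ∷ x) (b′ ∷ x′) y y′ =
  trans (cong (_ +_) (dist-++ x x′ y y′)) (sym (+-assoc _ (dist x x′) (dist y y′)))

∣weight-weight∣≤dist : ∀ {n} (x y : Vec Bool n) → ∣ weight x - weight y ∣ ≤ dist x y
∣weight-weight∣≤dist []          []          = z≤n
∣weight-weight∣≤dist (true  ∷ x) (true  ∷ y) = ∣weight-weight∣≤dist x y
∣weight-weight∣≤dist (false ∷ x) (false ∷ y) = ∣weight-weight∣≤dist x y
∣weight-weight∣≤dist (true  ∷ x) (false ∷ y) =
  ≤-trans (∣1+m-n∣≤1+∣m-n∣ (weight x) (weight y)) (s≤s (∣weight-weight∣≤dist x y))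
∣weight-weight∣≤dist (false ∷ x) (true  ∷ y) =
  ≤-trans (∣m-1+n∣≤1+∣m-n∣ (weight x) (weight y)) (s≤s (∣weight-weight∣≤dist x y))

threshold : (m : ℕ) → ℕ → Vec Bool m
threshold zero    _       = []
threshold (suc m) zero    = true  ∷ threshold m zero
threshold (suc m) (suc a) = false ∷ threshold m a

weight-threshold : ∀ m a → weight (threshold m a) ≡ m ∸ a
weight-threshold zero    zero    = refl
weight-threshold zero    (suc a) = refl
weight-threshold (suc m) zero    = cong suc (weight-threshold m zero)
weight-threshold (suc m) (suc a) = weight-threshold m a

dist-threshold : ∀ m a b → dist (threshold m a) (threshold m b) ≤ ∣ a - b ∣
dist-threshold zero    a       b       = z≤n
dist-threshold (suc m) zero    zero    = dist-threshold m zero zero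
dist-threshold (suc m) zero    (suc b) = s≤s (dist-threshold m zero b)
dist-threshold (suc m) (suc a) zero    =
  s≤s (≤-trans (dist-threshold m a zero) (≤-reflexive (∣-∣-identityʳ a)))
dist-threshold (suc m) (suc a) (suc b) = dist-threshold m a b

Majority-weight : ∀ {n} (z : Vec Bool (suc (2 * n))) b → weight z ≡ n + bit b → Majority z ≡ b
Majority-weight {n} z false w rewrite w =
  <ᵇ-false (≤-trans (*-monoʳ-≤ 2 (≤-reflexive (+-identityʳ n))) (n≤1+n (2 * n)))
Majority-weight {n} z true  w rewrite w =
  <ᵇ-true (≤-reflexive (sym (trans (*-distribˡ-+ 2 n 1) (+-comm (2 * n) 2))))

-- The trailing [] makes the length suc (n + (n + 0)), which is suc (2 * n) definitionally.
embed : ∀ {n} → Vec Bool n → Vec Bool (suc (2 * n))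
embed {n} x = false ∷ threshold n (2 * ⌊ weight x /2⌋) ++ x ++ []

embed-injective : ∀ {n} (x y : Vec Bool n) → embed x ≡ embed y → x ≡ y
embed-injective {n} x y eq =
  ++-injectiveˡ x y (++-injectiveʳ (threshold n _) (threshold n _) (∷-injectiveʳ eq))

weight-embed : ∀ {n} (x : Vec Bool n) → weight (embed x) ≡ n + bit (parity (weight x))
weight-embed {n} x = begin
  weight (threshold n e ++ x ++ [])  ≡⟨ weight-++ (threshold n e) (x ++ []) ⟩
  weight (threshold n e) + weight (x ++ [])
    ≡⟨ cong₂ _+_ (weight-threshold n e) (trans (weight-++ x []) (+-identityʳ k)) ⟩
  (n ∸ e) + k                        ≡⟨ cong ((n ∸ e) +_) (2*⌊n/2⌋+parity≡n k) ⟨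
  (n ∸ e) + (e + bit (parity k))     ≡⟨ +-assoc (n ∸ e) e _ ⟨
  (n ∸ e) + e + bit (parity k)       ≡⟨ cong (_+ bit (parity k)) (m∸n+n≡m e≤n) ⟩
  n + bit (parity k)                 ∎
  where
  open ≡-Reasoning
  k = weight x
  e = 2 * ⌊ k /2⌋
  e≤n : e ≤ n
  e≤n = ≤-trans (2*⌊n/2⌋≤n k) (weight≤length x)

dist-embed : ∀ {n} (x y : Vec Bool n) → dist (embed x) (embed y) ≤ 3 * dist x y
dist-embed {n} x y = begin
  dist (threshold n (2 * ⌊ a /2⌋) ++ x ++ []) (threshold n (2 * ⌊ b /2⌋) ++ y ++ [])
    ≡⟨ dist-++ (threshold n _) (threshold n _) (x ++ []) (y ++ []) ⟩
  dist (threshold n (2 * ⌊ a /2⌋)) (threshold n (2 * ⌊ b /2⌋)) + dist (x ++ []) (y ++ [])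
    ≡⟨ cong (dist (threshold n _) (threshold n _) +_) (trans (dist-++ x y [] []) (+-identityʳ d)) ⟩
  dist (threshold n (2 * ⌊ a /2⌋)) (threshold n (2 * ⌊ b /2⌋)) + d
    ≤⟨ +-monoˡ-≤ d (dist-threshold n _ _) ⟩
  ∣ 2 * ⌊ a /2⌋ - 2 * ⌊ b /2⌋ ∣ + d  ≤⟨ +-monoˡ-≤ d (∣2*⌊m/2⌋-2*⌊n/2⌋∣≤2*∣m-n∣ a b) ⟩
  2 * ∣ a - b ∣ + d                 ≤⟨ +-monoˡ-≤ d (*-monoʳ-≤ 2 (∣weight-weight∣≤dist x y)) ⟩
  2 * d + d                         ≡⟨ +-comm (2 * d) d ⟩
  3 * d                             ∎
  where
  open ≤-Reasoning
  a = weight x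
  b = weight y
  d = dist x y

theorem1p3 : (n : ℕ) →
    Σ (Vec Bool n → Vec Bool (suc (2 * n))) λ φ →
      (∀ x y → φ x ≡ φ y → x ≡ y) ×
      (∀ x y → dist (φ x) (φ y) ≤ 3 * dist x y) ×
      (∀ x → XOR x ≡ Majority (φ x))
theorem1p3 n =
  embed , embed-injective , dist-embed ,
  λ x → sym (Majority-weight (embed x) (parity (weight x)) (weight-embed x))
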